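{- Let $n\ge2$, $k\ge3$, $\varepsilon>0$ and let $f:S_k^n\to[k]$ be a social choice function with $\mathbf{D}(f,\overline{\mathrm{NONMANIP}})\ge\varepsilon$. Let $a\ne b$ be alternatives and let $z\in\{ -1,1\}^n$ be such that $B:=B_1^{a,b}(z)$ is a small fiber. Consider the subgraph of the rankings graph induced on $F^{a,b}(z)$ (two profiles adjacent iff they differ in exactly one coordinate; this graph is isomorphic to the Cartesian product of $n$ complete graphs on $k!/2$ vertices). Let $\partial_e(B)$ be the set of edges of this graph between $B$ and $F^{a,b}(z)\setminus B$, and $\partial(B)$ the set of $\sigma\in B$ having a neighbor in $F^{a,b}(z)\setminus B$. Then $$|\partial_e(B)|\ge\frac{\varepsilon^3}{4n^3k^9}|B|\qquad\text{and}\qquad \mathbb{P}(\sigma\in\partial(B))\ge\frac{\varepsilon^3}{2n^4k^9\,k!}\,\mathbb{P}(\sigma\in B),$$ where $\sigma\in S_k^n$ is uniform.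
   Context: $S_k$ is the set of total orderings of $[k]$; a social choice function is $f:S_k^n\to[k]$. $\overline{\mathrm{NONMANIP}}$ is the set of SCFs depending on only one coordinate or taking at most two values; $\mathbf{D}(f,G)=\min_{g\in G}\mathbb{P}(f(\sigma)\ne g(\sigma))$. $B_1^{a,b}$ is the set of pairs $(\sigma,\sigma')$ differing exactly in coordinate $1$ with $f(\sigma)=a$, $f(\sigma')=b$. $x^{a,b}(\sigma)\in\{ -1,1\}^n$ has $x^{a,b}_j(\sigma)=1$ iff $\sigma_j$ ranks $a$ above $b$. $F^{a,b}(z)=\{\sigma:x^{a,b}(\sigma)=z\}$ and $B_1^{a,b}(z)=\{\sigma\in F^{a,b}(z): f(\sigma)=a,\ \exists\sigma'\text{ with }(\sigma,\sigma')\in B_1^{a,b}\}$. The fiber $B_1^{a,b}(z)$ is small if $\mathbb{P}(\sigma\in B_1^{a,b}(z)\mid\sigma\in F^{a,b}(z))<1-\frac{\varepsilon^3}{4n^3k^9}$.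
   Formalization: The parameter ε ranges over the positive rationals. -}

module Defs where

open import Data.Bool using (Bool; true; false; _∧_; _∨_; not; if_then_else_; T)
open import Data.Bool.Properties using (T?) renaming (_≟_ to _≟ᵇ_)
open import Data.Nat using (ℕ; zero; suc; _≤_)
open import Data.Fin as Fin using (Fin; zero; suc)
open import Data.Vec as Vec using (Vec; []; _∷_; lookup)
open import Data.Vec.Properties using (≡-dec)
open import Data.List as List using (List; []; _∷_; concatMap; length; mapMaybe; filterᵇ; allFin; cartesianProduct)
open import Data.Bool.ListAction using (any; all)
open import Data.Maybe using (Maybe; just; nothing)
open import Data.Product using (Σ; _,_; proj₁; proj₂; ∃-syntax; _×_)
open import Data.Sum using (_⊎_)
open import Data.Integer using (+_)
open import Data.Rational using (ℚ; _/_; 0ℚ)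
open import Relation.Nullary.Decidable using (⌊_⌋; yes; no)
open import Relation.Binary.PropositionalEquality using (_≡_)

_=ᶠ_ : ∀ {k} → Fin k → Fin k → Bool
a =ᶠ b = ⌊ a Fin.≟ b ⌋

elemᶠ : ∀ {k m} → Fin k → Vec (Fin k) m → Bool
elemᶠ a [] = false
elemᶠ a (x ∷ xs) = (a =ᶠ x) ∨ elemᶠ a xs

distinct : ∀ {k m} → Vec (Fin k) m → Bool
distinct [] = true
distinct (x ∷ xs) = not (elemᶠ x xs) ∧ distinct xs

-- S_k : total orderings of [k] = Fin k, written as the list of all k
-- alternatives (without repetition) from most preferred to least preferred.

Ranking : ℕ → Set
Ranking k = Σ (Vec (Fin k) k) (λ v → T (distinct v))

_=ᴿ_ : ∀ {k} → Ranking k → Ranking k → Bool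
r =ᴿ s = ⌊ ≡-dec Fin._≟_ (proj₁ r) (proj₁ s) ⌋

aboveV : ∀ {k m} → Vec (Fin k) m → Fin k → Fin k → Bool
aboveV [] a b = false
aboveV (x ∷ xs) a b = if x =ᶠ a then true else (if x =ᶠ b then false else aboveV xs a b)

above : ∀ {k} → Ranking k → Fin k → Fin k → Bool
above r a b = aboveV (proj₁ r) a b

Profile : ℕ → ℕ → Set
Profile n k = Vec (Ranking k) n

SCF : ℕ → ℕ → Set
SCF n k = Profile n k → Fin k

vecsOver : ∀ {A : Set} → List A → (m : ℕ) → List (Vec A m)
vecsOver xs zero = [] ∷ []
vecsOver xs (suc m) = concatMap (λ x → List.map (x ∷_) (vecsOver xs m)) xs

toRanking : ∀ {k} → Vec (Fin k) k → Maybe (Ranking k)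
toRanking v with T? (distinct v)
... | yes p = just (v , p)
... | no _ = nothing

allRankings : (k : ℕ) → List (Ranking k)
allRankings k = mapMaybe toRanking (vecsOver (allFin k) k)

allProfiles : (n k : ℕ) → List (Profile n k)
allProfiles n k = vecsOver (allRankings k) n

countᵇ : ∀ {A : Set} → (A → Bool) → List A → ℕ
countᵇ P xs = length (filterᵇ P xs)

-- m / d as a rational, with the convention m / 0 = 0
frac : ℕ → ℕ → ℚ
frac m zero = 0ℚ
frac m (suc d) = (+ m) / suc d

Prob : ∀ n k → (Profile n k → Bool) → ℚ
Prob n k P = frac (countᵇ P (allProfiles n k)) (length (allProfiles n k))

CondProb : ∀ n k → (Profile n k → Bool) → (Profile n k → Bool) → ℚ
CondProb n k P Q =
  frac (countᵇ (λ σ → P σ ∧ Q σ) (allProfiles n k)) (countᵇ Q (allProfiles n k))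

DependsOnOneCoord : ∀ n k → SCF n k → Set
DependsOnOneCoord n k g =
  ∃[ i ] (∀ (σ σ' : Profile n k) → lookup σ i ≡ lookup σ' i → g σ ≡ g σ')

AtMostTwoValues : ∀ n k → SCF n k → Set
AtMostTwoValues n k g = ∃[ c ] ∃[ d ] (∀ (σ : Profile n k) → (g σ ≡ c) ⊎ (g σ ≡ d))

NonManipBar : ∀ n k → SCF n k → Set
NonManipBar n k g = DependsOnOneCoord n k g ⊎ AtMostTwoValues n k g

-- D(f, NONMANIP-bar) ≥ ε  (min over the finite set ≥ ε  iff  every member is ≥ ε)
DistNonManipAtLeast : ∀ n k → SCF n k → ℚ → Set
DistNonManipAtLeast n k f ε =
  ∀ (g : SCF n k) → NonManipBar n k g → ε Data.Rational.≤ Prob n k (λ σ → not (f σ =ᶠ g σ))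

diffExactly : ∀ {n k} → Fin n → Profile n k → Profile n k → Bool
diffExactly {n} i σ σ' =
  all (λ j → if j =ᶠ i then not (lookup σ j =ᴿ lookup σ' j) else (lookup σ j =ᴿ lookup σ' j)) (allFin n)

adjacent : ∀ {n k} → Profile n k → Profile n k → Bool
adjacent {n} σ σ' = any (λ i → diffExactly i σ σ') (allFin n)

-- x^{a,b}(σ) ∈ {-1,1}^n, encoded with true = 1, false = -1
xab : ∀ {n k} → Fin k → Fin k → Profile n k → Vec Bool n
xab a b σ = Vec.map (λ r → above r a b) σ

inF : ∀ {n k} → Fin k → Fin k → Vec Bool n → Profile n k → Bool
inF a b z σ = ⌊ ≡-dec _≟ᵇ_ (xab a b σ) z ⌋

-- coordinate "1" (the first coordinate) of a profile with n ≥ 2 voters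
first : ∀ {n} → 2 ≤ n → Fin n
first {suc n} _ = zero

inB : ∀ {n k} → SCF n k → Fin n → Fin k → Fin k → Vec Bool n → Profile n k → Bool
inB {n} {k} f i a b z σ =
  inF a b z σ ∧ (f σ =ᶠ a) ∧ any (λ σ' → diffExactly i σ σ' ∧ (f σ' =ᶠ b)) (allProfiles n k)

-- |∂_e(B)| : edges of the graph induced on F between B ⊆ F and F \ B
-- (counted as pairs (σ, τ) with σ ∈ B, τ ∈ F \ B adjacent; each edge once)
edgeBoundarySize : ∀ n k → (B F : Profile n k → Bool) → ℕ
edgeBoundarySize n k B F =
  countᵇ (λ p → B (proj₁ p) ∧ F (proj₂ p) ∧ not (B (proj₂ p)) ∧ adjacent (proj₁ p) (proj₂ p))
         (cartesianProduct (allProfiles n k) (allProfiles n k))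

inVertexBoundary : ∀ n k → (B F : Profile n k → Bool) → Profile n k → Bool
inVertexBoundary n k B F σ =
  B σ ∧ any (λ τ → F τ ∧ not (B τ) ∧ adjacent σ τ) (allProfiles n k)

module Submission where

-- Only the shape of the fiber matters: F = F^{a,b}(z) is cut out coordinatewise, so it is a
-- product of per-voter sets of rankings, and B = B_1^{a,b}(z) is a subset of F. For every such F
-- and every B ⊆ F a canonical-path argument gives
--     |B| · |F ∖ B| ≤ |∂ₑB| · |F|     and     |B| · |F ∖ B| ≤ n · |∂B| · |F|.
-- Given x ∈ B and y ∈ F ∖ B, walk from x to y replacing one coordinate of x by that of y at a time;
-- all these splices stay in F. The walk leaves B along a boundary edge (u, u'), and u together with
-- the complementary splice w ∈ F and the changed coordinate determines (x, y) again.
-- That B is small means |F ∖ B| > δ |F| with δ = ε³ / (4 n³ k⁹), so the first inequality yields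
-- |∂ₑB| ≥ δ |B| and the second |∂B| ≥ δ |B| / n ≥ ε³ / (2 n⁴ k⁹ k!) · |B| (as k! ≥ 2); dividing by
-- the number of profiles turns the latter into the bound on probabilities.

module Counting where

  open import Data.Bool using (Bool; true; false; T; not; _∧_)
  open import Data.Bool.Properties using (T?)
  open import Data.Nat using (suc; _+_; _*_; _≤_; z≤n; s≤s)
  open import Data.Nat.Properties using (+-suc; ≤-trans; ≤-reflexive)
  open import Data.List using (List; []; _∷_; _++_; map; length; filterᵇ; cartesianProduct)
  open import Data.List.Properties using (length-++; length-++-sucʳ; length-map; filter-++)
  open import Data.List.Membership.Propositional using (_∈_)
  open import Data.List.Membership.Propositional.Properties
    using (∈-∃++; ∈-++⁻; ∈-++⁺ˡ; ∈-++⁺ʳ; ∈-map⁻; ∈-filter⁺; ∈-filter⁻)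
  open import Data.List.Relation.Binary.Subset.Propositional using (_⊆_)
  open import Data.List.Relation.Unary.Any using (here; there)
  open import Data.List.Relation.Unary.All as All using ([]; _∷_)
  open import Data.List.Relation.Unary.AllPairs using ([]; _∷_)
  import Data.List.Relation.Unary.All.Properties as All
  open import Data.List.Relation.Unary.Unique.Propositional using (Unique)
  import Data.List.Relation.Unary.Unique.Propositional.Properties as Unique
  open import Data.Product using (_×_; _,_; proj₁; proj₂)
  open import Data.Sum using (inj₁; inj₂)
  open import Data.Empty using (⊥-elim)
  open import Function using (_∘_)
  open import Relation.Binary.PropositionalEquality using (_≡_; refl; sym; trans; cong; cong₂; subst)
  open Relation.Binary.PropositionalEquality.≡-Reasoning
  open import Defs using (countᵇ)

  countᵇ-++ : {A : Set} (P : A → Bool) (xs ys : List A) → countᵇ P (xs ++ ys) ≡ countᵇ P xs + countᵇ P ys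
  countᵇ-++ P xs ys = trans (cong length (filter-++ (T? ∘ P) xs ys)) (length-++ (filterᵇ P xs))

  countᵇ-map : {A B : Set} (P : B → Bool) (g : A → B) (xs : List A) → countᵇ P (map g xs) ≡ countᵇ (P ∘ g) xs
  countᵇ-map P g [] = refl
  countᵇ-map P g (x ∷ xs) with P (g x)
  ... | true = cong suc (countᵇ-map P g xs)
  ... | false = countᵇ-map P g xs

  countᵇ-true : {A : Set} (xs : List A) → countᵇ (λ _ → true) xs ≡ length xs
  countᵇ-true [] = refl
  countᵇ-true (x ∷ xs) = cong suc (countᵇ-true xs)

  countᵇ-false : {A : Set} (xs : List A) → countᵇ (λ _ → false) xs ≡ 0
  countᵇ-false [] = refl
  countᵇ-false (x ∷ xs) = countᵇ-false xs

  countᵇ-restrict : {A : Set} (P Q : A → Bool) (xs : List A) → (∀ {x} → T (P x) → T (Q x)) →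
    countᵇ (λ x → P x ∧ Q x) xs ≡ countᵇ P xs
  countᵇ-restrict P Q [] P⊆Q = refl
  countᵇ-restrict P Q (x ∷ xs) P⊆Q with P x in Px | Q x in Qx
  ... | false | _ = countᵇ-restrict P Q xs P⊆Q
  ... | true | true = cong suc (countᵇ-restrict P Q xs P⊆Q)
  ... | true | false = ⊥-elim (subst T Qx (P⊆Q (subst T (sym Px) _)))

  countᵇ-complement : {A : Set} (P Q : A → Bool) (xs : List A) → (∀ {x} → T (P x) → T (Q x)) →
    countᵇ P xs + countᵇ (λ x → Q x ∧ not (P x)) xs ≡ countᵇ Q xs
  countᵇ-complement P Q [] P⊆Q = refl
  countᵇ-complement P Q (x ∷ xs) P⊆Q with P x in Px | Q x in Qx
  ... | false | false = countᵇ-complement P Q xs P⊆Q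
  ... | false | true = trans (+-suc _ _) (cong suc (countᵇ-complement P Q xs P⊆Q))
  ... | true | true = cong suc (countᵇ-complement P Q xs P⊆Q)
  ... | true | false = ⊥-elim (subst T Qx (P⊆Q (subst T (sym Px) _)))

  countᵇ-× : {A B : Set} (P : A → Bool) (Q : B → Bool) (xs : List A) (ys : List B) →
    countᵇ (λ p → P (proj₁ p) ∧ Q (proj₂ p)) (cartesianProduct xs ys) ≡ countᵇ P xs * countᵇ Q ys
  countᵇ-× P Q [] ys = refl
  countᵇ-× P Q (x ∷ xs) ys = begin
      countᵇ R (map (x ,_) ys ++ cartesianProduct xs ys)
    ≡⟨ countᵇ-++ R (map (x ,_) ys) (cartesianProduct xs ys) ⟩
      countᵇ R (map (x ,_) ys) + countᵇ R (cartesianProduct xs ys)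
    ≡⟨ cong₂ _+_ (countᵇ-map R (x ,_) ys) (countᵇ-× P Q xs ys) ⟩
      countᵇ (λ y → P x ∧ Q y) ys + countᵇ P xs * countᵇ Q ys
    ≡⟨ row ⟩
      countᵇ P (x ∷ xs) * countᵇ Q ys
    ∎
    where
    R = λ p → P (proj₁ p) ∧ Q (proj₂ p)
    row : countᵇ (λ y → P x ∧ Q y) ys + countᵇ P xs * countᵇ Q ys ≡ countᵇ P (x ∷ xs) * countᵇ Q ys
    row with P x
    ... | true = refl
    ... | false = cong (_+ countᵇ P xs * countᵇ Q ys) (countᵇ-false ys)

  unique-⊆-length : {A : Set} {xs ys : List A} → Unique xs → xs ⊆ ys → length xs ≤ length ys
  unique-⊆-length {xs = []} [] _ = z≤n
  unique-⊆-length {xs = x ∷ xs} (x∉xs ∷ uxs) xs⊆ys with ∈-∃++ (xs⊆ys (here refl))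
  ... | ys₁ , ys₂ , refl = ≤-trans (s≤s (unique-⊆-length uxs xs⊆ys₁ys₂))
                                   (≤-reflexive (sym (length-++-sucʳ ys₁ x ys₂)))
    where
    xs⊆ys₁ys₂ : xs ⊆ ys₁ ++ ys₂
    xs⊆ys₁ys₂ {y} y∈xs with ∈-++⁻ ys₁ (xs⊆ys (there y∈xs))
    ... | inj₁ y∈ys₁ = ∈-++⁺ˡ y∈ys₁
    ... | inj₂ (here refl) = ⊥-elim (All.lookup x∉xs y∈xs refl)
    ... | inj₂ (there y∈ys₂) = ∈-++⁺ʳ ys₁ y∈ys₂

  unique-map⁺ : {A B : Set} {g : A → B} {xs : List A} →
    (∀ {x x'} → x ∈ xs → x' ∈ xs → g x ≡ g x' → x ≡ x') → Unique xs → Unique (map g xs)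
  unique-map⁺ injective [] = []
  unique-map⁺ injective (x∉xs ∷ uxs) =
    All.map⁺ (All.tabulate λ x'∈xs gx≡gx' → All.lookup x∉xs x'∈xs (injective (here refl) (there x'∈xs) gx≡gx'))
    ∷ unique-map⁺ (λ p p' → injective (there p) (there p')) uxs

  countᵇ-≤-injection : {A B : Set} (P : A → Bool) (Q : B → Bool) (g : A → B) {xs : List A} {ys : List B} →
    Unique xs →
    (∀ {x} → x ∈ xs → T (P x) → g x ∈ ys × T (Q (g x))) →
    (∀ {x x'} → x ∈ xs → x' ∈ xs → T (P x) → T (P x') → g x ≡ g x' → x ≡ x') →
    countᵇ P xs ≤ countᵇ Q ys
  countᵇ-≤-injection P Q g {xs} {ys} uxs maps-into injective =
    ≤-trans (≤-reflexive (sym (length-map g (filterᵇ P xs))))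
      (unique-⊆-length (unique-map⁺ injective-on-filter (Unique.filter⁺ (T? ∘ P) uxs)) image⊆)
    where
    selected : ∀ {x} → x ∈ filterᵇ P xs → x ∈ xs × T (P x)
    selected = ∈-filter⁻ (T? ∘ P)
    injective-on-filter : ∀ {x x'} → x ∈ filterᵇ P xs → x' ∈ filterᵇ P xs → g x ≡ g x' → x ≡ x'
    injective-on-filter p p' with selected p | selected p'
    ... | x∈ , Px | x'∈ , Px' = injective x∈ x'∈ Px Px'
    image⊆ : map g (filterᵇ P xs) ⊆ filterᵇ Q ys
    image⊆ y∈ with ∈-map⁻ g y∈
    ... | x , x∈ , refl with selected x∈
    ... | x∈xs , Px with maps-into x∈xs Px
    ... | gx∈ys , Qgx = ∈-filter⁺ (T? ∘ Q) gx∈ys Qgx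

module Enumeration where

  open import Data.Bool.Properties using (T?; T-irrelevant)
  open import Data.Nat using (ℕ; zero; suc)
  open import Data.Fin using (Fin)
  open import Data.Vec as Vec using (Vec; []; _∷_)
  open import Data.List using (List; []; _∷_; map; concatMap; mapMaybe; allFin)
  open import Data.List.Membership.Propositional using (_∈_)
  open import Data.List.Membership.Propositional.Properties
    using (∈-concatMap⁺; ∈-map⁺; ∈-map⁻; ∈-++⁻; ∈-allFin)
  open import Data.List.Relation.Unary.Any as Any using (here; there)
  open import Data.List.Relation.Unary.All as All using ([]; _∷_)
  open import Data.List.Relation.Unary.AllPairs using ([]; _∷_)
  open import Data.List.Relation.Unary.Unique.Propositional using (Unique)
  import Data.List.Relation.Unary.Unique.Propositional.Properties as Unique
  open import Data.Maybe using (Maybe; just; nothing)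
  open import Data.Product using (_,_; proj₁; _×_)
  open import Data.Sum using (inj₁; inj₂)
  open import Data.Empty using (⊥; ⊥-elim)
  open import Relation.Nullary using (yes; no)
  open import Relation.Binary.PropositionalEquality using (_≡_; refl; sym; trans; cong)
  open import Defs

  vecsOver-complete : {A : Set} (xs : List A) {m : ℕ} (v : Vec A m) → (∀ a → a ∈ xs) → v ∈ vecsOver xs m
  vecsOver-complete xs [] every = here refl
  vecsOver-complete xs (a ∷ v) every =
    ∈-concatMap⁺ (λ x → map (x ∷_) (vecsOver xs _))
      (Any.map (λ { refl → ∈-map⁺ (a ∷_) (vecsOver-complete xs v every) }) (every a))

  vecsOver-unique : {A : Set} {xs : List A} (m : ℕ) → Unique xs → Unique (vecsOver xs m)
  vecsOver-unique zero uxs = [] ∷ []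
  vecsOver-unique {A} {xs} (suc m) uxs = blocks-unique xs uxs
    where
    block : A → List (Vec A (suc m))
    block a = map (a ∷_) (vecsOver xs m)
    head∈ : ∀ {v} (as : List A) → v ∈ concatMap block as → Vec.head v ∈ as
    head∈ (a ∷ as) v∈ with ∈-++⁻ (block a) v∈
    ... | inj₁ v∈block with ∈-map⁻ (a ∷_) v∈block
    ...   | _ , _ , refl = here refl
    head∈ (a ∷ as) v∈ | inj₂ v∈rest = there (head∈ as v∈rest)
    blocks-unique : (as : List A) → Unique as → Unique (concatMap block as)
    blocks-unique [] [] = []
    blocks-unique (a ∷ as) (a∉as ∷ uas) =
      Unique.++⁺ (Unique.map⁺ (λ { refl → refl }) (vecsOver-unique m uxs)) (blocks-unique as uas) disjoint
      where
      disjoint : ∀ {v} → v ∈ block a × v ∈ concatMap block as → ⊥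
      disjoint (v∈block , v∈rest) with ∈-map⁻ (a ∷_) v∈block
      ... | _ , _ , refl = All.lookup a∉as (head∈ as v∈rest) refl

  module PartialInverse {A B : Set} (emb : B → A) (proj : A → Maybe B)
    (proj-emb : ∀ b → proj (emb b) ≡ just b) (proj-just : ∀ {a b} → proj a ≡ just b → emb b ≡ a) where

    mapMaybe⁺ : ∀ {b} (as : List A) → emb b ∈ as → b ∈ mapMaybe proj as
    mapMaybe⁺ {b} (a ∷ as) (here refl) rewrite proj-emb b = here refl
    mapMaybe⁺ (a ∷ as) (there b∈) with proj a
    ... | nothing = mapMaybe⁺ as b∈
    ... | just _ = there (mapMaybe⁺ as b∈)

    mapMaybe⁻ : ∀ {b} (as : List A) → b ∈ mapMaybe proj as → emb b ∈ as
    mapMaybe⁻ (a ∷ as) b∈ with proj a in eq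
    ... | nothing = there (mapMaybe⁻ as b∈)
    mapMaybe⁻ (a ∷ as) (here refl) | just b = here (proj-just eq)
    mapMaybe⁻ (a ∷ as) (there b∈) | just _ = there (mapMaybe⁻ as b∈)

    mapMaybe-unique : (as : List A) → Unique as → Unique (mapMaybe proj as)
    mapMaybe-unique [] [] = []
    mapMaybe-unique (a ∷ as) (a∉as ∷ uas) with proj a in eq
    ... | nothing = mapMaybe-unique as uas
    ... | just b = All.tabulate (λ b'∈ b≡b' → All.lookup a∉as (mapMaybe⁻ as b'∈)
                                                 (trans (sym (proj-just eq)) (cong emb b≡b')))
                   ∷ mapMaybe-unique as uas

  ranking-ext : ∀ {k} {r s : Ranking k} → proj₁ r ≡ proj₁ s → r ≡ s
  ranking-ext {r = v , p} {s = .v , q} refl = cong (v ,_) (T-irrelevant p q)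

  toRanking-proj₁ : ∀ {k} (r : Ranking k) → toRanking (proj₁ r) ≡ just r
  toRanking-proj₁ (v , p) with T? (distinct v)
  ... | yes _ = cong just (ranking-ext refl)
  ... | no ¬p = ⊥-elim (¬p p)

  toRanking-just : ∀ {k} {v : Vec (Fin k) k} {r} → toRanking v ≡ just r → proj₁ r ≡ v
  toRanking-just {v = v} eq with T? (distinct v)
  toRanking-just refl | yes _ = refl

  module RankingFilter (k : ℕ) =
    PartialInverse {Vec (Fin k) k} {Ranking k} proj₁ toRanking toRanking-proj₁ toRanking-just

  allRankings-complete : ∀ {k} (r : Ranking k) → r ∈ allRankings k
  allRankings-complete {k} r = RankingFilter.mapMaybe⁺ k _ (vecsOver-complete (allFin k) (proj₁ r) ∈-allFin)

  allRankings-unique : ∀ k → Unique (allRankings k)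
  allRankings-unique k = RankingFilter.mapMaybe-unique k _ (vecsOver-unique k (Unique.allFin⁺ k))

  allProfiles-complete : ∀ {n k} (σ : Profile n k) → σ ∈ allProfiles n k
  allProfiles-complete σ = vecsOver-complete _ σ allRankings-complete

  allProfiles-unique : ∀ n k → Unique (allProfiles n k)
  allProfiles-unique n k = vecsOver-unique n (allRankings-unique k)

module Splicing where

  open import Data.Nat using (ℕ; zero; suc; pred)
  open import Data.Fin using (Fin; zero; suc; toℕ)
  open import Data.Vec using (Vec; []; _∷_; lookup; map)
  open import Data.Product using (_×_; _,_)
  open import Data.Empty using (⊥-elim)
  open import Relation.Binary.PropositionalEquality using (_≡_; _≢_; refl; cong)

  -- splice i x y takes its first i coordinates from x and the remaining ones from y;
  -- j ↦ splice j y x is a path from x to y changing one coordinate per step.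
  splice : {A : Set} {n : ℕ} → ℕ → Vec A n → Vec A n → Vec A n
  splice zero x y = y
  splice (suc i) [] [] = []
  splice (suc i) (a ∷ x) (b ∷ y) = a ∷ splice i x y

  splice-all : {A : Set} {n : ℕ} (x y : Vec A n) → splice n x y ≡ x
  splice-all [] [] = refl
  splice-all (a ∷ x) (b ∷ y) = cong (a ∷_) (splice-all x y)

  splice-idem : {A : Set} {n : ℕ} (i : ℕ) (x : Vec A n) → splice i x x ≡ x
  splice-idem zero x = refl
  splice-idem (suc i) [] = refl
  splice-idem (suc i) (a ∷ x) = cong (a ∷_) (splice-idem i x)

  splice-recover : {A : Set} {n : ℕ} (i : ℕ) (x y : Vec A n) → splice i (splice i x y) (splice i y x) ≡ x
  splice-recover zero x y = refl
  splice-recover (suc i) [] [] = refl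
  splice-recover (suc i) (a ∷ x) (b ∷ y) = cong (a ∷_) (splice-recover i x y)

  map-splice : {A B : Set} {n : ℕ} (f : A → B) (i : ℕ) (x y : Vec A n) →
    map f (splice i x y) ≡ splice i (map f x) (map f y)
  map-splice f zero x y = refl
  map-splice f (suc i) [] [] = refl
  map-splice f (suc i) (a ∷ x) (b ∷ y) = cong (f a ∷_) (map-splice f i x y)

  lookup-splice-at : {A : Set} {n : ℕ} (i : ℕ) (y x : Vec A n) (j : Fin n) → toℕ j ≡ i →
    lookup (splice i y x) j ≡ lookup x j × lookup (splice (suc i) y x) j ≡ lookup y j
  lookup-splice-at zero (b ∷ y) (a ∷ x) zero refl = refl , refl
  lookup-splice-at (suc i) (b ∷ y) (a ∷ x) (suc j) j≡i = lookup-splice-at i y x j (cong pred j≡i)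

  lookup-splice-off : {A : Set} {n : ℕ} (i : ℕ) (y x : Vec A n) (j : Fin n) → toℕ j ≢ i →
    lookup (splice i y x) j ≡ lookup (splice (suc i) y x) j
  lookup-splice-off zero (b ∷ y) (a ∷ x) zero j≢i = ⊥-elim (j≢i refl)
  lookup-splice-off zero (b ∷ y) (a ∷ x) (suc j) j≢i = refl
  lookup-splice-off (suc i) (b ∷ y) (a ∷ x) zero j≢i = refl
  lookup-splice-off (suc i) (b ∷ y) (a ∷ x) (suc j) j≢i = lookup-splice-off i y x j (λ e → j≢i (cong suc e))

  splice-stationary : {A : Set} {n : ℕ} (i : ℕ) (y x : Vec A n) (j : Fin n) → toℕ j ≡ i →
    lookup y j ≡ lookup x j → splice (suc i) y x ≡ splice i y x
  splice-stationary zero (b ∷ y) (a ∷ x) zero refl b≡a = cong (_∷ x) b≡a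
  splice-stationary (suc i) (b ∷ y) (a ∷ x) (suc j) j≡i yj≡xj =
    cong (b ∷_) (splice-stationary i y x j (cong pred j≡i) yj≡xj)

module Adjacency where

  open import Data.Bool using (Bool; true; false; T; not; _∧_; if_then_else_)
  open import Data.Bool.Properties using (T-∧)
  open import Data.Fin as Fin using (Fin)
  open import Data.Vec using (lookup)
  open import Data.List using (allFin)
  open import Data.List.Membership.Propositional.Properties using (∈-allFin)
  import Data.List.Relation.Unary.All as All
  import Data.List.Relation.Unary.All.Properties as All
  import Data.List.Relation.Unary.Any as Any
  import Data.List.Relation.Unary.Any.Properties as Any
  open import Data.Product using (_×_; _,_; proj₁; proj₂)
  open import Data.Empty using (⊥-elim)
  open import Relation.Nullary using (yes; no; ¬_)
  open import Relation.Nullary.Decidable using (toWitness; fromWitness)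
  open import Function.Bundles using (Equivalence)
  open import Relation.Binary.PropositionalEquality using (_≡_; _≢_; refl)
  open import Defs
  open Enumeration using (ranking-ext)

  =ᴿ-sound : ∀ {k} {r s : Ranking k} → T (r =ᴿ s) → r ≡ s
  =ᴿ-sound r=s = ranking-ext (toWitness r=s)

  =ᴿ-complete : ∀ {k} {r s : Ranking k} → r ≡ s → T (r =ᴿ s)
  =ᴿ-complete refl = fromWitness refl

  T-∧⁺ : ∀ {a b} → T a → T b → T (a ∧ b)
  T-∧⁺ ta tb = Equivalence.from T-∧ (ta , tb)

  T-∧⁻ : ∀ {a b} → T (a ∧ b) → T a × T b
  T-∧⁻ = Equivalence.to T-∧

  T-not⇒¬T : ∀ {b} → T (not b) → ¬ T b
  T-not⇒¬T {true} ()

  ¬T⇒T-not : ∀ {b} → ¬ T b → T (not b)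
  ¬T⇒T-not {false} _ = _
  ¬T⇒T-not {true} ¬t = ¬t _

  private
    differsOnlyAt : ∀ {n k} → Fin n → Profile n k → Profile n k → Fin n → Bool
    differsOnlyAt c u v j = if j =ᶠ c then not (lookup u j =ᴿ lookup v j) else (lookup u j =ᴿ lookup v j)

  diffExactly⁺ : ∀ {n k} {c : Fin n} (u v : Profile n k) → lookup u c ≢ lookup v c →
    (∀ j → j ≢ c → lookup u j ≡ lookup v j) → T (diffExactly c u v)
  diffExactly⁺ {n} {c = c} u v differ agree =
    All.all⁻ (differsOnlyAt c u v) {xs = allFin n} (All.tabulate λ {j} _ → test j)
    where
    test : ∀ j → T (differsOnlyAt c u v j)
    test j with j Fin.≟ c
    ... | no j≢c = =ᴿ-complete (agree j j≢c)
    ... | yes refl = ¬T⇒T-not (λ u=v → differ (=ᴿ-sound u=v))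

  diffExactly⁻ : ∀ {n k} {c : Fin n} (u v : Profile n k) → T (diffExactly c u v) →
    lookup u c ≢ lookup v c × (∀ j → j ≢ c → lookup u j ≡ lookup v j)
  diffExactly⁻ {n} {c = c} u v d = at-c (test c) , λ j j≢c → off-c j j≢c (test j)
    where
    test : ∀ j → T (differsOnlyAt c u v j)
    test j = All.lookup (All.all⁺ (differsOnlyAt c u v) (allFin n) d) (∈-allFin j)
    at-c : T (differsOnlyAt c u v c) → lookup u c ≢ lookup v c
    at-c t with c Fin.≟ c
    ... | no c≢c = ⊥-elim (c≢c refl)
    ... | yes _ = λ u≡v → T-not⇒¬T t (=ᴿ-complete u≡v)
    off-c : ∀ j → j ≢ c → T (differsOnlyAt c u v j) → lookup u j ≡ lookup v j
    off-c j j≢c t with j Fin.≟ c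
    ... | yes j≡c = ⊥-elim (j≢c j≡c)
    ... | no _ = =ᴿ-sound t

  diffExactly-coordinate : ∀ {n k} {c c' : Fin n} (u v : Profile n k) →
    T (diffExactly c u v) → T (diffExactly c' u v) → c ≡ c'
  diffExactly-coordinate {c = c} {c'} u v d d' with c Fin.≟ c'
  ... | yes c≡c' = c≡c'
  ... | no c≢c' = ⊥-elim (proj₁ (diffExactly⁻ u v d) (proj₂ (diffExactly⁻ u v d') c c≢c'))

  diffExactly⇒adjacent : ∀ {n k} {c : Fin n} (u v : Profile n k) → T (diffExactly c u v) → T (adjacent u v)
  diffExactly⇒adjacent {c = c} u v d =
    Any.any⁺ (λ i → diffExactly i u v) (Any.map (λ { refl → d }) (∈-allFin c))

module Isoperimetry where

  open import Data.Bool using (Bool; true; false; T; not; _∧_; if_then_else_)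
  open import Data.Nat using (ℕ; zero; suc; _*_; _≤_; _<_)
  open import Data.Nat.Properties using (≤-refl; m≤n⇒m≤1+n)
  open import Data.Fin using (toℕ; fromℕ<)
  open import Data.Fin.Properties using (toℕ-fromℕ<; toℕ-injective)
  open import Data.Vec using (lookup)
  open import Data.List using (List; upTo; cartesianProduct)
  open import Data.List.Properties using (length-upTo)
  open import Data.List.Membership.Propositional using (_∈_)
  open import Data.List.Membership.Propositional.Properties using (∈-cartesianProduct⁺; ∈-upTo⁺)
  import Data.List.Relation.Unary.Unique.Propositional.Properties as Unique
  open import Data.Product using (_×_; _,_; proj₁; proj₂)
  open import Data.Empty using (⊥-elim)
  import Data.List.Relation.Unary.Any as Any
  import Data.List.Relation.Unary.Any.Properties as Any
  open import Relation.Nullary using (¬_)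
  open import Relation.Binary.PropositionalEquality using (_≡_; _≢_; refl; sym; trans; cong; cong₂; subst; subst₂)
  open import Defs
  open Counting
  open Enumeration
  open Splicing
  open Adjacency

  -- crossing g m is the last j < m with g j true (0 if there is none).
  crossing : (ℕ → Bool) → ℕ → ℕ
  crossing g zero = 0
  crossing g (suc m) = if g m then m else crossing g m

  crossing-spec : (g : ℕ → Bool) (m : ℕ) → T (g 0) → ¬ T (g m) →
    crossing g m < m × T (g (crossing g m)) × ¬ T (g (suc (crossing g m)))
  crossing-spec g zero g0 ¬gm = ⊥-elim (¬gm g0)
  crossing-spec g (suc m) g0 ¬gsm with g m in eq
  ... | true = ≤-refl , subst T (sym eq) _ , ¬gsm
  ... | false with crossing-spec g m g0 (λ gm → subst T eq gm)
  ...   | c<m , gc , ¬gsc = m≤n⇒m≤1+n c<m , gc , ¬gsc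

  path-step : ∀ {n k} (i : ℕ) (i<n : i < n) (y x : Profile n k) → splice (suc i) y x ≢ splice i y x →
    T (diffExactly (fromℕ< i<n) (splice i y x) (splice (suc i) y x))
  path-step i i<n y x moved = diffExactly⁺ (splice i y x) (splice (suc i) y x) differ agree
    where
    c = fromℕ< i<n
    c-is-i : toℕ c ≡ i
    c-is-i = toℕ-fromℕ< i<n
    differ : lookup (splice i y x) c ≢ lookup (splice (suc i) y x) c
    differ same with lookup-splice-at i y x c c-is-i
    ... | at-i , at-suc-i = moved (splice-stationary i y x c c-is-i (trans (sym at-suc-i) (trans (sym same) at-i)))
    agree : ∀ j → j ≢ c → lookup (splice i y x) j ≡ lookup (splice (suc i) y x) j
    agree j j≢c = lookup-splice-off i y x j (λ j-is-i → j≢c (toℕ-injective (trans j-is-i (sym c-is-i))))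

  module CanonicalPaths {n k : ℕ} (F B : Profile n k → Bool)
    (F-splice : ∀ i {x y} → T (F x) → T (F y) → T (F (splice i x y)))
    (B⊆F : ∀ {σ} → T (B σ) → T (F σ)) where

    profiles : List (Profile n k)
    profiles = allProfiles n k

    crossIndex : Profile n k → Profile n k → ℕ
    crossIndex x y = crossing (λ j → B (splice j y x)) n

    entry exit companion : Profile n k → Profile n k → Profile n k
    entry x y = splice (crossIndex x y) y x
    exit x y = splice (suc (crossIndex x y)) y x
    companion x y = splice (crossIndex x y) x y

    record CrossingEdge (x y : Profile n k) : Set where
      field
        index<n : crossIndex x y < n
        entry∈B : T (B (entry x y))
        exit∉B : ¬ T (B (exit x y))
        exit∈F : T (F (exit x y))
        companion∈F : T (F (companion x y))
        edge : T (diffExactly (fromℕ< index<n) (entry x y) (exit x y))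

    crossingEdge : ∀ {x y} → T (B x) → T (F y) → ¬ T (B y) → CrossingEdge x y
    crossingEdge {x} {y} x∈B y∈F y∉B
      with crossing-spec (λ j → B (splice j y x)) n x∈B (λ y∈B → y∉B (subst (λ σ → T (B σ)) (splice-all y x) y∈B))
    ... | i<n , u∈B , u'∉B = record
      { index<n = i<n ; entry∈B = u∈B ; exit∉B = u'∉B
      ; exit∈F = F-splice (suc i) y∈F x∈F ; companion∈F = F-splice i x∈F y∈F
      ; edge = path-step i i<n y x (λ same → u'∉B (subst (λ σ → T (B σ)) (sym same) u∈B)) }
      where
      i = crossIndex x y
      x∈F = B⊆F x∈B

    index-determined : ∀ {x y x' y'} → CrossingEdge x y → CrossingEdge x' y' →
      entry x y ≡ entry x' y' → exit x y ≡ exit x' y' → crossIndex x y ≡ crossIndex x' y'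
    index-determined {x} {y} {x'} {y'} c c' same-entry same-exit =
      trans (sym (toℕ-fromℕ< (index<n c)))
        (trans (cong toℕ (diffExactly-coordinate (entry x y) (exit x y) (edge c) edge'))
               (toℕ-fromℕ< (index<n c')))
      where
      open CrossingEdge
      edge' : T (diffExactly (fromℕ< (index<n c')) (entry x y) (exit x y))
      edge' = subst₂ (λ u v → T (diffExactly (fromℕ< (index<n c')) u v)) (sym same-entry) (sym same-exit) (edge c')

    pair-determined : ∀ {x y x' y'} → crossIndex x y ≡ crossIndex x' y' →
      entry x y ≡ entry x' y' → companion x y ≡ companion x' y' → (x , y) ≡ (x' , y')
    pair-determined {x} {y} {x'} {y'} same-index same-entry same-companion = cong₂ _,_
      (trans (sym (splice-recover (crossIndex x y) x y))
        (trans (cong₂ (λ i p → splice i (proj₁ p) (proj₂ p)) same-index (cong₂ _,_ same-companion same-entry))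
               (splice-recover (crossIndex x' y') x' y')))
      (trans (sym (splice-recover (crossIndex x y) y x))
        (trans (cong₂ (λ i p → splice i (proj₁ p) (proj₂ p)) same-index (cong₂ _,_ same-entry same-companion))
               (splice-recover (crossIndex x' y') y' x')))

    outside : Profile n k → Bool
    outside y = F y ∧ not (B y)

    separated : Profile n k × Profile n k → Bool
    separated p = B (proj₁ p) ∧ outside (proj₂ p)

    separated-crossing : ∀ {x y} → T (separated (x , y)) → CrossingEdge x y
    separated-crossing sep with T-∧⁻ sep
    ... | x∈B , y-out with T-∧⁻ y-out
    ...   | y∈F , y∉B = crossingEdge x∈B y∈F (T-not⇒¬T y∉B)

    profile-pairs : List (Profile n k × Profile n k)
    profile-pairs = cartesianProduct profiles profiles

    ∈-profile-pairs : ∀ p → p ∈ profile-pairs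
    ∈-profile-pairs (x , y) = ∈-cartesianProduct⁺ (allProfiles-complete x) (allProfiles-complete y)

    separated-count : countᵇ separated profile-pairs ≡ countᵇ B profiles * countᵇ outside profiles
    separated-count = countᵇ-× B outside profiles profiles

    boundaryEdge : Profile n k × Profile n k → Bool
    boundaryEdge p = B (proj₁ p) ∧ F (proj₂ p) ∧ not (B (proj₂ p)) ∧ adjacent (proj₁ p) (proj₂ p)

    crossing-boundaryEdge : ∀ {x y} → CrossingEdge x y → T (boundaryEdge (entry x y , exit x y))
    crossing-boundaryEdge {x} {y} c =
      T-∧⁺ (entry∈B c) (T-∧⁺ (exit∈F c) (T-∧⁺ (¬T⇒T-not (exit∉B c)) (diffExactly⇒adjacent (entry x y) (exit x y) (edge c))))
      where open CrossingEdge

    -- Edge isoperimetry |B| · |F ∖ B| ≤ |∂ₑ B| · |F|, since (x, y) ↦ ((entry, exit), companion)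
    -- is injective on B × (F ∖ B).
    edge-isoperimetry : countᵇ B profiles * countᵇ outside profiles ≤ edgeBoundarySize n k B F * countᵇ F profiles
    edge-isoperimetry = subst₂ _≤_ separated-count (countᵇ-× boundaryEdge F profile-pairs profiles)
      (countᵇ-≤-injection separated (λ q → boundaryEdge (proj₁ q) ∧ F (proj₂ q)) toEdge
        (Unique.cartesianProduct⁺ (allProfiles-unique n k) (allProfiles-unique n k)) maps-into injective)
      where
      toEdge : Profile n k × Profile n k → (Profile n k × Profile n k) × Profile n k
      toEdge (x , y) = (entry x y , exit x y) , companion x y
      maps-into : ∀ {p} → p ∈ profile-pairs → T (separated p) →
        toEdge p ∈ cartesianProduct profile-pairs profiles × T (boundaryEdge (proj₁ (toEdge p)) ∧ F (proj₂ (toEdge p)))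
      maps-into {x , y} _ sep =
        ∈-cartesianProduct⁺ (∈-profile-pairs _) (allProfiles-complete _) ,
        T-∧⁺ (crossing-boundaryEdge c) (CrossingEdge.companion∈F c)
        where c = separated-crossing sep
      injective : ∀ {p p'} → p ∈ profile-pairs → p' ∈ profile-pairs → T (separated p) → T (separated p') →
        toEdge p ≡ toEdge p' → p ≡ p'
      injective {x , y} {x' , y'} _ _ sep sep' same =
        pair-determined
          (index-determined (separated-crossing sep) (separated-crossing sep') same-entry same-exit)
          same-entry (cong proj₂ same)
        where
        same-entry = cong (λ q → proj₁ (proj₁ q)) same
        same-exit = cong (λ q → proj₂ (proj₁ q)) same

    boundaryVertex : Profile n k → Bool
    boundaryVertex = inVertexBoundary n k B F

    crossing-boundaryVertex : ∀ {x y} → CrossingEdge x y → T (boundaryVertex (entry x y))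
    crossing-boundaryVertex {x} {y} c = T-∧⁺ (CrossingEdge.entry∈B c)
      (Any.any⁺ _ (Any.map (λ { refl → exit-outside }) (allProfiles-complete (exit x y))))
      where
      exit-outside : T (F (exit x y) ∧ not (B (exit x y)) ∧ adjacent (entry x y) (exit x y))
      exit-outside = proj₂ (T-∧⁻ {B (entry x y)} (crossing-boundaryEdge c))

    -- Vertex isoperimetry |B| · |F ∖ B| ≤ n · |∂B| · |F|, since (x, y) ↦ (index, entry, companion)
    -- is injective on B × (F ∖ B).
    vertex-isoperimetry : countᵇ B profiles * countᵇ outside profiles ≤ n * (countᵇ boundaryVertex profiles * countᵇ F profiles)
    vertex-isoperimetry = subst₂ _≤_ separated-count target-count
      (countᵇ-≤-injection separated target toVertex
        (Unique.cartesianProduct⁺ (allProfiles-unique n k) (allProfiles-unique n k)) maps-into injective)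
      where
      target : ℕ × (Profile n k × Profile n k) → Bool
      target q = true ∧ (boundaryVertex (proj₁ (proj₂ q)) ∧ F (proj₂ (proj₂ q)))
      target-count : countᵇ target (cartesianProduct (upTo n) profile-pairs) ≡ n * (countᵇ boundaryVertex profiles * countᵇ F profiles)
      target-count = trans (countᵇ-× (λ _ → true) _ (upTo n) profile-pairs)
        (cong₂ _*_ (trans (countᵇ-true (upTo n)) (length-upTo n)) (countᵇ-× boundaryVertex F profiles profiles))
      toVertex : Profile n k × Profile n k → ℕ × (Profile n k × Profile n k)
      toVertex (x , y) = crossIndex x y , (entry x y , companion x y)
      maps-into : ∀ {p} → p ∈ profile-pairs → T (separated p) →
        toVertex p ∈ cartesianProduct (upTo n) profile-pairs × T (target (toVertex p))
      maps-into {x , y} _ sep =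
        ∈-cartesianProduct⁺ (∈-upTo⁺ (CrossingEdge.index<n c)) (∈-profile-pairs _) ,
        T-∧⁺ (crossing-boundaryVertex c) (CrossingEdge.companion∈F c)
        where c = separated-crossing sep
      injective : ∀ {p p'} → p ∈ profile-pairs → p' ∈ profile-pairs → T (separated p) → T (separated p') →
        toVertex p ≡ toVertex p' → p ≡ p'
      injective {x , y} {x' , y'} _ _ _ _ same =
        pair-determined (cong proj₁ same) (cong (λ q → proj₁ (proj₂ q)) same) (cong (λ q → proj₂ (proj₂ q)) same)

module RationalBounds where

  open import Data.Nat as ℕ using (ℕ; zero; suc)
  import Data.Nat.Properties as ℕ
  open import Data.Nat.Tactic.RingSolver using (solve-∀)
  open import Data.Integer as ℤ using (+_; +≤+)
  import Data.Integer.Properties as ℤ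
  open import Data.Rational using (ℚ; 0ℚ; 1ℚ; _+_; _*_; _-_; _<_; _≤_; toℚᵘ; NonNegative; Positive)
  import Data.Rational.Properties as ℚ
  open import Data.Rational.Solver using (module +-*-Solver)
  open +-*-Solver using (solve; _:+_; _:*_; _:-_; _:=_; con)
  import Data.Rational.Unnormalised as ℚᵘ
  import Data.Rational.Unnormalised.Properties as ℚᵘ
  open import Relation.Binary.PropositionalEquality using (_≡_; refl; sym; trans; cong; cong₂; subst; subst₂)
  open import Defs using (frac)

  frac-toℚᵘ : ∀ m d → toℚᵘ (frac m (suc d)) ℚᵘ.≃ ℚᵘ.mkℚᵘ (+ m) d
  frac-toℚᵘ m d = ℚ.toℚᵘ-fromℚᵘ (ℚᵘ.mkℚᵘ (+ m) d)

  frac-≤ : ∀ m d m' d' → m ℕ.* suc d' ℕ.≤ m' ℕ.* suc d → frac m (suc d) ≤ frac m' (suc d')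
  frac-≤ m d m' d' cross = ℚ.toℚᵘ-cancel-≤
    (ℚᵘ.≤-respˡ-≃ (ℚᵘ.≃-sym (frac-toℚᵘ m d)) (ℚᵘ.≤-respʳ-≃ (ℚᵘ.≃-sym (frac-toℚᵘ m' d'))
      (ℚᵘ.*≤* (subst₂ ℤ._≤_ (ℤ.pos-* m (suc d')) (ℤ.pos-* m' (suc d)) (+≤+ cross)))))

  frac-≡ : ∀ m d m' d' → m ℕ.* suc d' ≡ m' ℕ.* suc d → frac m (suc d) ≡ frac m' (suc d')
  frac-≡ m d m' d' cross =
    ℚ.≤-antisym (frac-≤ m d m' d' (ℕ.≤-reflexive cross)) (frac-≤ m' d' m d (ℕ.≤-reflexive (sym cross)))

  frac-* : ∀ m d m' d' → frac m (suc d) * frac m' (suc d') ≡ frac (m ℕ.* m') (suc d ℕ.* suc d')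
  frac-* m d m' d' = ℚ.toℚᵘ-injective
    (ℚᵘ.≃-trans (ℚ.toℚᵘ-homo-* (frac m (suc d)) (frac m' (suc d')))
    (ℚᵘ.≃-trans (ℚᵘ.*-cong (frac-toℚᵘ m d) (frac-toℚᵘ m' d'))
    (ℚᵘ.≃-trans (ℚᵘ.≃-reflexive (cong (λ i → ℚᵘ.mkℚᵘ i (d' ℕ.+ d ℕ.* suc d')) (sym (ℤ.pos-* m m'))))
      (ℚᵘ.≃-sym (frac-toℚᵘ (m ℕ.* m') (d' ℕ.+ d ℕ.* suc d'))))))

  ι : ℕ → ℚ
  ι m = frac m 1

  ι-nonNeg : ∀ m → NonNegative (ι m)
  ι-nonNeg m = ℚ.normalize-nonNeg m 1

  ι-pos : ∀ m → Positive (ι (suc m))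
  ι-pos m = ℚ.normalize-pos (suc m) 1

  ι-mono : ∀ {m m'} → m ℕ.≤ m' → ι m ≤ ι m'
  ι-mono {m} {m'} m≤m' = frac-≤ m 0 m' 0 (ℕ.*-monoˡ-≤ 1 m≤m')

  ι-* : ∀ m m' → ι (m ℕ.* m') ≡ ι m * ι m'
  ι-* m m' = sym (frac-* m 0 m' 0)

  ι-+ : ∀ m m' → ι (m ℕ.+ m') ≡ ι m + ι m'
  ι-+ m m' = sym (ℚ.toℚᵘ-injective
    (ℚᵘ.≃-trans (ℚ.toℚᵘ-homo-+ (ι m) (ι m'))
    (ℚᵘ.≃-trans (ℚᵘ.+-cong (frac-toℚᵘ m 0) (frac-toℚᵘ m' 0))
    (ℚᵘ.≃-trans (ℚᵘ.*≡* integer-sum) (ℚᵘ.≃-sym (frac-toℚᵘ (m ℕ.+ m') 0))))))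
    where
    integer-sum : (+ m ℤ.* + 1 ℤ.+ + m' ℤ.* + 1) ℤ.* + 1 ≡ + (m ℕ.+ m') ℤ.* + 1
    integer-sum = cong (ℤ._* + 1)
      (trans (cong₂ ℤ._+_ (ℤ.*-identityʳ (+ m)) (ℤ.*-identityʳ (+ m'))) (sym (ℤ.pos-+ m m')))

  frac-scale : ∀ m d → frac m (suc d) ≡ ι m * frac 1 (suc d)
  frac-scale m d = sym (trans (frac-* m 0 1 d) (frac-≡ (m ℕ.* 1) (d ℕ.+ 0) m d (identity m d)))
    where
    identity : ∀ m d → m ℕ.* 1 ℕ.* suc d ≡ m ℕ.* suc (d ℕ.+ 0)
    identity = solve-∀

  frac-cancel : ∀ m d → frac m (suc d) * ι (suc d) ≡ ι m
  frac-cancel m d = trans (frac-* m d (suc d) 0) (frac-≡ (m ℕ.* suc d) (d ℕ.* 1) m 0 (identity m d))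
    where
    identity : ∀ m d → m ℕ.* suc d ℕ.* 1 ≡ m ℕ.* suc (d ℕ.* 1)
    identity = solve-∀

  complement-density : (δ : ℚ) (B C f : ℕ) → B ℕ.+ C ≡ suc f → frac B (suc f) < 1ℚ - δ → δ * ι (suc f) < ι C
  complement-density δ B C f B+C≡F small = begin-strict
      δ * ι F                                ≡⟨ solve 3 (λ d b x → d :* x := b :+ (d :* x :- b)) refl δ (ι B) (ι F) ⟩
      ι B + (δ * ι F - ι B)                  <⟨ ℚ.+-monoˡ-< (δ * ι F - ι B) scaled ⟩
      (1ℚ - δ) * ι F + (δ * ι F - ι B)       ≡⟨ cong (λ x → (1ℚ - δ) * x + (δ * x - ι B)) F-splits ⟩
      (1ℚ - δ) * (ι B + ι C) + (δ * (ι B + ι C) - ι B)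
        ≡⟨ solve 3 (λ d b c → (con 1ℚ :- d) :* (b :+ c) :+ (d :* (b :+ c) :- b) := c) refl δ (ι B) (ι C) ⟩
      ι C                                    ∎
    where
    open ℚ.≤-Reasoning
    F = suc f
    F-splits : ι F ≡ ι B + ι C
    F-splits = trans (cong ι (sym B+C≡F)) (ι-+ B C)
    scaled : ι B < (1ℚ - δ) * ι F
    scaled = subst (_< (1ℚ - δ) * ι F) (frac-cancel B f) (ℚ.*-monoˡ-<-pos (ι F) {{ι-pos f}} small)

  isoperimetric-ratio : (δ : ℚ) (B C F M : ℕ) → B ℕ.+ C ≡ F → frac B F < 1ℚ - δ →
    B ℕ.* C ℕ.≤ M ℕ.* F → δ * ι B ≤ ι M
  isoperimetric-ratio δ B C zero M B+C≡0 _ _ rewrite ℕ.m+n≡0⇒m≡0 B B+C≡0 = begin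
      δ * 0ℚ   ≡⟨ ℚ.*-zeroʳ δ ⟩
      0ℚ       ≤⟨ ℚ.nonNegative⁻¹ (ι M) {{ι-nonNeg M}} ⟩
      ι M      ∎
    where open ℚ.≤-Reasoning
  isoperimetric-ratio δ B C (suc f) M B+C≡F small BC≤MF = ℚ.*-cancelʳ-≤-pos (ι F) {{ι-pos f}} (begin
      δ * ι B * ι F     ≡⟨ solve 3 (λ d b x → d :* b :* x := b :* (d :* x)) refl δ (ι B) (ι F) ⟩
      ι B * (δ * ι F)   ≤⟨ ℚ.*-monoˡ-≤-nonNeg (ι B) {{ι-nonNeg B}} (ℚ.<⇒≤ (complement-density δ B C f B+C≡F small)) ⟩
      ι B * ι C         ≡⟨ sym (ι-* B C) ⟩
      ι (B ℕ.* C)       ≤⟨ ι-mono BC≤MF ⟩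
      ι (M ℕ.* F)       ≡⟨ ι-* M F ⟩
      ι M * ι F         ∎)
    where
    open ℚ.≤-Reasoning
    F = suc f

  divide-by-factor : (δ δ' : ℚ) (m B V : ℕ) → δ' * ι (suc m) ≤ δ → δ * ι B ≤ ι (suc m ℕ.* V) →
    δ' * ι B ≤ ι V
  divide-by-factor δ δ' m B V δ'm≤δ δB≤mV = ℚ.*-cancelʳ-≤-pos (ι (suc m)) {{ι-pos m}} (begin
      δ' * ι B * ι (suc m)    ≡⟨ solve 3 (λ e b x → e :* b :* x := e :* x :* b) refl δ' (ι B) (ι (suc m)) ⟩
      δ' * ι (suc m) * ι B    ≤⟨ ℚ.*-monoʳ-≤-nonNeg (ι B) {{ι-nonNeg B}} δ'm≤δ ⟩
      δ * ι B                 ≤⟨ δB≤mV ⟩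
      ι (suc m ℕ.* V)         ≡⟨ trans (ι-* (suc m) V) (ℚ.*-comm (ι (suc m)) (ι V)) ⟩
      ι V * ι (suc m)         ∎)
    where open ℚ.≤-Reasoning

  normalise-bound : (δ : ℚ) (B V N : ℕ) → δ * ι B ≤ ι V → δ * frac B N ≤ frac V N
  normalise-bound δ B V zero _ = ℚ.≤-reflexive (ℚ.*-zeroʳ δ)
  normalise-bound δ B V (suc N) δB≤V = begin
      δ * frac B (suc N)      ≡⟨ cong (δ *_) (frac-scale B N) ⟩
      δ * (ι B * w)           ≡⟨ sym (ℚ.*-assoc δ (ι B) w) ⟩
      δ * ι B * w             ≤⟨ ℚ.*-monoʳ-≤-nonNeg w {{ℚ.normalize-nonNeg 1 (suc N)}} δB≤V ⟩
      ι V * w                 ≡⟨ sym (frac-scale V N) ⟩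
      frac V (suc N)          ∎
    where
    open ℚ.≤-Reasoning
    w = frac 1 (suc N)

  constant-comparison : (d : ℚ) → .{{NonNegative d}} → (c c' m : ℕ) → 0 ℕ.< c → 0 ℕ.< c' →
    m ℕ.* c ℕ.≤ c' → d * frac 1 c' * ι m ≤ d * frac 1 c
  constant-comparison d (suc c) (suc c') m _ _ mc≤c' = begin
      d * frac 1 (suc c') * ι m              ≡⟨ ℚ.*-assoc d (frac 1 (suc c')) (ι m) ⟩
      d * (frac 1 (suc c') * ι m)            ≡⟨ cong (d *_) (frac-* 1 c' m 0) ⟩
      d * frac (1 ℕ.* m) (suc c' ℕ.* 1)      ≤⟨ ℚ.*-monoˡ-≤-nonNeg d (frac-≤ (1 ℕ.* m) (c' ℕ.* 1) 1 c cross) ⟩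
      d * frac 1 (suc c)                     ∎
    where
    open ℚ.≤-Reasoning
    cross : 1 ℕ.* m ℕ.* suc c ℕ.≤ 1 ℕ.* suc (c' ℕ.* 1)
    cross = subst₂ ℕ._≤_ (identityˡ m (suc c)) (identityʳ c') mc≤c'
      where
      identityˡ : ∀ m c → m ℕ.* c ≡ 1 ℕ.* m ℕ.* c
      identityˡ = solve-∀
      identityʳ : ∀ c' → suc c' ≡ 1 ℕ.* suc (c' ℕ.* 1)
      identityʳ = solve-∀

open import Defs
open import Data.Bool using (Bool)
open import Data.Nat using (ℕ; _≤_; _*_; _^_; _!)
open import Data.Fin using (Fin)
open import Data.Vec using (Vec)
open import Data.Product using (_×_)
open import Data.Rational using (ℚ; 0ℚ; 1ℚ; _-_; _<_) renaming (_≤_ to _≤ℚ_; _*_ to _*ℚ_)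
open import Relation.Binary.PropositionalEquality using (_≢_)

open import Data.Bool using (T)
open import Data.Nat using (suc; _+_; z≤n; s≤s)
import Data.Nat.Properties as ℕ
open import Data.Nat.Tactic.RingSolver using (solve-∀)
import Data.Rational as ℚ
import Data.Rational.Properties as ℚ
open import Data.Product using (_,_; proj₁)
open import Data.List using (length)
open import Relation.Nullary.Decidable using (toWitness; fromWitness)
open import Relation.Binary.PropositionalEquality using (_≡_; sym; cong₂; subst)
open Relation.Binary.PropositionalEquality.≡-Reasoning
open Counting using (countᵇ-restrict; countᵇ-complement)
open Splicing using (splice; map-splice; splice-idem)
open Adjacency using (T-∧⁻)
open Isoperimetry using (module CanonicalPaths)
open RationalBounds

-- The fiber F^{a,b}(z) is cut out coordinatewise, so it is closed under splicing ...
inF-splice : ∀ {n k} (a b : Fin k) (z : Vec Bool n) (i : ℕ) {x y : Profile n k} →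
  T (inF a b z x) → T (inF a b z y) → T (inF a b z (splice i x y))
inF-splice a b z i {x} {y} x∈F y∈F = fromWitness (begin
    xab a b (splice i x y)                 ≡⟨ map-splice (λ r → above r a b) i x y ⟩
    splice i (xab a b x) (xab a b y)       ≡⟨ cong₂ (splice i) (toWitness x∈F) (toWitness y∈F) ⟩
    splice i z z                           ≡⟨ splice-idem i z ⟩
    z                                      ∎)

inB⊆inF : ∀ {n k} (f : SCF n k) (i : Fin n) (a b : Fin k) (z : Vec Bool n) {σ : Profile n k} →
  T (inB f i a b z σ) → T (inF a b z σ)
inB⊆inF f i a b z σ∈B = proj₁ (T-∧⁻ σ∈B)

-- The vertex constant times n is at most the edge constant:
-- ε³ / (2 n⁴ k⁹ k!) · n ≤ ε³ / (4 n³ k⁹), because n · 4 n³ k⁹ = 2 n⁴ k⁹ · 2 and 2 ≤ k!.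
vertex-constant≤edge-constant : (m k' : ℕ) (ε : ℚ) → 0ℚ < ε →
  let n = suc m
      k = suc (suc k')
  in (ε *ℚ ε *ℚ ε) *ℚ frac 1 (2 * n ^ 4 * k ^ 9 * (k !)) *ℚ ι n ≤ℚ (ε *ℚ ε *ℚ ε) *ℚ frac 1 (4 * n ^ 3 * k ^ 9)
vertex-constant≤edge-constant m k' ε ε>0 =
  constant-comparison (ε *ℚ ε *ℚ ε) {{ε³≥0}} c c' n (s≤s z≤n) (ℕ.<-≤-trans (s≤s z≤n) nc≤c') nc≤c'
  where
  n = suc m
  k = suc (suc k')
  c = 4 * n ^ 3 * k ^ 9
  c' = 2 * n ^ 4 * k ^ 9 * (k !)
  -- stated with n³ and k⁹ abstracted, since n ^ 4 unfolds to n * n ^ 3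
  rearrange : ∀ n n³ k⁹ → n * (4 * n³ * k⁹) ≡ 2 * (n * n³) * k⁹ * 2
  rearrange = solve-∀
  nc≤c' : n * c ≤ c'
  nc≤c' = subst (_≤ c') (sym (rearrange n (n ^ 3) (k ^ 9)))
    (ℕ.*-monoʳ-≤ (2 * n ^ 4 * k ^ 9) (ℕ.*-mono-≤ {2} {k} {1} (s≤s (s≤s z≤n)) (ℕ.1≤n! (suc k'))))
  instance
    ε-positive : ℚ.Positive ε
    ε-positive = ℚ.positive ε>0
  ε³≥0 : ℚ.NonNegative (ε *ℚ ε *ℚ ε)
  ε³≥0 = ℚ.pos⇒nonNeg (ε *ℚ ε *ℚ ε) {{ℚ.pos*pos⇒pos (ε *ℚ ε) {{ℚ.pos*pos⇒pos ε ε}} ε}}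

lemma3p5 : (n k : ℕ) → (h : 2 ≤ n) → 3 ≤ k → (ε : ℚ) → 0ℚ < ε →
    (f : SCF n k) → DistNonManipAtLeast n k f ε →
    (a b : Fin k) → a ≢ b → (z : Vec Bool n) →
    CondProb n k (inB f (first h) a b z) (inF a b z)
      < 1ℚ - (ε *ℚ ε *ℚ ε) *ℚ frac 1 (4 * n ^ 3 * k ^ 9) →
    ((ε *ℚ ε *ℚ ε) *ℚ frac 1 (4 * n ^ 3 * k ^ 9)
        *ℚ frac (countᵇ (inB f (first h) a b z) (allProfiles n k)) 1
      ≤ℚ frac (edgeBoundarySize n k (inB f (first h) a b z) (inF a b z)) 1)
    ×
    ((ε *ℚ ε *ℚ ε) *ℚ frac 1 (2 * n ^ 4 * k ^ 9 * (k !))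
        *ℚ Prob n k (inB f (first h) a b z)
      ≤ℚ Prob n k (inVertexBoundary n k (inB f (first h) a b z) (inF a b z)))
lemma3p5 n@(suc m) k@(suc (suc k')) h@(s≤s _) (s≤s (s≤s _)) ε ε>0 f _ a b _ z small-fiber =
  edge-bound , vertex-bound
  where
  B = inB f (first h) a b z
  F = inF a b z
  B⊆F = inB⊆inF f (first h) a b z
  open CanonicalPaths F B (inF-splice a b z) B⊆F
  δ = (ε *ℚ ε *ℚ ε) *ℚ frac 1 (4 * n ^ 3 * k ^ 9)
  δ' = (ε *ℚ ε *ℚ ε) *ℚ frac 1 (2 * n ^ 4 * k ^ 9 * (k !))
  #B #F #out #∂ : ℕ
  #B = countᵇ B profiles
  #F = countᵇ F profiles
  #out = countᵇ outside profiles
  #∂ = countᵇ boundaryVertex profiles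
  split : #B + #out ≡ #F
  split = countᵇ-complement B F profiles B⊆F
  small : frac #B #F < 1ℚ - δ
  small = subst (λ x → frac x #F < 1ℚ - δ) (countᵇ-restrict B F profiles B⊆F) small-fiber
  edge-bound : δ *ℚ ι #B ≤ℚ ι (edgeBoundarySize n k B F)
  edge-bound = isoperimetric-ratio δ #B #out #F (edgeBoundarySize n k B F) split small edge-isoperimetry
  vertex-count-bound : δ *ℚ ι #B ≤ℚ ι (n * #∂)
  vertex-count-bound = isoperimetric-ratio δ #B #out #F (n * #∂) split small
    (subst (#B * #out ≤_) (sym (ℕ.*-assoc n #∂ #F)) vertex-isoperimetry)
  vertex-bound : δ' *ℚ Prob n k B ≤ℚ Prob n k boundaryVertex
  vertex-bound = normalise-bound δ' #B #∂ (length profiles)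
    (divide-by-factor δ δ' m #B #∂ (vertex-constant≤edge-constant m k' ε ε>0) vertex-count-bound)
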